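{- Let $G$ be a loopless multigraph of maximum degree $\Delta\ge 2$, let $\phi$ be a proper partial $\lfloor 3\Delta/2\rfloor$-edge-coloring, $e$ an uncolored edge, $x\in V(e)$, $y$ the other endpoint of $e$, and $\alpha,\beta$ colors with $\alpha\in M(\phi,x)\setminus M(\phi,y)$ and $\beta\in M(\phi,y)$. Let $(F,\gamma,\delta)$ be the output of the Next Shannon Fan procedure on input $(\phi,e,x,\alpha,\beta)$. Then no edge in $F$ is colored $\alpha$, $\beta$, $\gamma$ or $\delta$ under $\phi$, and at least one of the following holds: (i) $\delta\in M(\phi,x)$ and $F$ is $\phi$-happy; (ii) $F$ has length $2$, $\delta=\beta$, and $F$ is $(\phi,\alpha\beta)$-hopeful; (iii) $F$ has length $2$, $\delta\ne\beta$, and $F$ is $(\phi,\gamma\delta)$-successful; (iv) $\delta\neq\beta$ and $e$ is $(\phi,\gamma\delta)$-successful.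
   Context: Colors are $[r]=\{1,\dots,r\}$ with $r=\lfloor 3\Delta/2\rfloor$, ordered as integers. A partial $r$-edge-coloring is $\phi:E(G)\to[r]\cup\{\mathsf{blank}\}$ (uncolored edges map to $\mathsf{blank}$); proper means distinct colored edges sharing an endpoint get distinct colors. $M(\phi,v)$ is the set of colors of $[r]$ not used on edges at $v$. A chain is a sequence $(e_0,\dots,e_{k-1})$ of distinct edges with $|V(e_i)\cap V(e_{i+1})|=1$; $\mathsf{Shift}(\phi,C)$ gives $e_i$ the color $\phi(e_{i+1})$ for $i<k-1$, uncolors $e_{k-1}$, keeps the rest; $C$ is $\phi$-shiftable if $\phi(e_0)=\mathsf{blank}$ and $\mathsf{Shift}(\phi,C)$ is proper; an uncolored edge with endpoints $u,v$ is $\phi$-happy if $M(\phi,u)\cap M(\phi,v)\ne\varnothing$; $C$ is $\phi$-happy if $\phi$-shiftable and its last edge is $\mathsf{Shift}(\phi,C)$-happy. $G(\phi,\alpha\beta)$ is the spanning subgraph of edges colored $\alpha$ or $\beta$, $\deg(v;\phi,\alpha\beta)$ the degree there, and $u,v$ are $(\phi,\alpha\beta)$-related if in the same component. An uncolored edge with endpoints $u,v$ is $(\phi,\alpha\beta)$-successful if both degrees are $<2$ and $u,v$ are not $(\phi,\alpha\beta)$-related. A fan is a chain whose edges share a common vertex (pivot); $\mathsf{vEnd}(F)$ is the non-pivot endpoint of its last edge. A $\phi$-shiftable, not $\phi$-happy fan $F$ with pivot $x$ and $y'=\mathsf{vEnd}(F)$ is $(\phi,\alpha\beta)$-hopeful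 if $\deg(x;\phi,\alpha\beta)<2$ and $\deg(y';\phi,\alpha\beta)<2$, and $(\phi,\alpha\beta)$-successful if additionally $x,y'$ are not $(\mathsf{Shift}(\phi,F),\alpha\beta)$-related. Next Shannon Fan procedure on $(\phi,e,x,\alpha,\beta)$: if $M(\phi,x)\cap M(\phi,y)\ne\varnothing$, let $\delta$ be its minimum and return $((e),\delta,\delta)$. Otherwise let $\eta=\min(M(\phi,y)\setminus\{\beta\})$, let $f$ be the edge at $x$ with $\phi(f)=\eta$, and $z$ its endpoint other than $x$. If $M(\phi,x)\cap M(\phi,z)\ne\varnothing$, let $\delta$ be its minimum and return $((e,f),\delta,\delta)$. Otherwise let $\delta=\min M(\phi,y)\cap M(\phi,z)$; if $\delta=\beta$ return $((e,f),\alpha,\beta)$ (so $\gamma=\alpha$); otherwise let $\gamma=\min(M(\phi,x)\setminus\{\alpha\})$ and return $((e,f),\gamma,\delta)$. The fan always has pivot $x$. -}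

module Defs where

open import Data.Nat using (ℕ; zero; suc; _≤_; _<_; _*_; ⌊_/2⌋)
open import Data.Fin using (Fin; _≟_)
open import Data.Fin.Base using ()
open import Data.List using (List; []; _∷_; length; filter; allFin)
open import Data.List.Membership.Propositional using (_∈_)
open import Data.List.Relation.Unary.All using (All)
open import Data.List.Relation.Unary.Unique.Propositional using (Unique)
open import Data.Maybe using (Maybe; just; nothing)
open import Data.Product using (Σ; ∃; ∃-syntax; _×_; _,_; proj₁; proj₂; swap)
open import Data.Sum using (_⊎_)
open import Relation.Nullary using (¬_; Dec; yes; no)
open import Relation.Nullary.Decidable using (_⊎-dec_)
open import Relation.Binary.PropositionalEquality using (_≡_; _≢_)
import Data.Maybe.Properties as MaybeP
import Data.Nat as N

-- Finite loopless multigraphs: vertices Fin n, edges Fin m, each edge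
-- has an (arbitrarily ordered) pair of distinct endpoints.

record Multigraph : Set where
  field
    n m      : ℕ
    ends     : Fin m → Fin n × Fin n
    loopless : ∀ e → proj₁ (ends e) ≢ proj₂ (ends e)

-- Colors are natural numbers; "blank" is `nothing`.
Color : Set
Color = ℕ

numColors : ℕ → ℕ
numColors Δ = ⌊ 3 * Δ /2⌋

IsMin : (Color → Set) → Color → Set
IsMin P d = P d × (∀ d' → P d' → d ≤ d')

data LastIs {A : Set} : List A → A → Set where
  last-one  : ∀ {a} → LastIs (a ∷ []) a
  last-cons : ∀ {a b xs} → LastIs xs b → LastIs (a ∷ xs) b

module _ (G : Multigraph) where
  open Multigraph G

  Vertex Edge : Set
  Vertex = Fin n
  Edge   = Fin m

  Coloring : Set
  Coloring = Edge → Maybe Color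

  IsEnd : Vertex → Edge → Set
  IsEnd v g = proj₁ (ends g) ≡ v ⊎ proj₂ (ends g) ≡ v

  isEnd? : ∀ v g → Dec (IsEnd v g)
  isEnd? v g = (proj₁ (ends g) ≟ v) ⊎-dec (proj₂ (ends g) ≟ v)

  EdgeBetween : Edge → Vertex → Vertex → Set
  EdgeBetween g u w = ends g ≡ (u , w) ⊎ ends g ≡ (w , u)

  deg : Vertex → ℕ
  deg v = length (filter (isEnd? v) (allFin m))

  MaxDegree : ℕ → Set
  MaxDegree Δ = (∀ v → deg v ≤ Δ) × ∃[ v ] deg v ≡ Δ

  IsPartialColoring : ℕ → Coloring → Set
  IsPartialColoring r φ = ∀ g c → φ g ≡ just c → 1 ≤ c × c ≤ r

  Adjacent : Edge → Edge → Set
  Adjacent g h = g ≢ h × ∃[ v ] (IsEnd v g × IsEnd v h)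

  Proper : Coloring → Set
  Proper φ = ∀ g h c → Adjacent g h → φ g ≡ just c → φ h ≢ just c

  Missing : ℕ → Coloring → Vertex → Color → Set
  Missing r φ v c = 1 ≤ c × c ≤ r × (∀ g → IsEnd v g → φ g ≢ just c)

  -- |V(g) ∩ V(h)| = 1  (loopless edges have two endpoints)
  SameEnds : Edge → Edge → Set
  SameEnds g h = ends g ≡ ends h ⊎ ends g ≡ swap (ends h)

  ShareOne : Edge → Edge → Set
  ShareOne g h = (∃[ v ] (IsEnd v g × IsEnd v h)) × ¬ SameEnds g h

  data Consecutive : List Edge → Set where
    cons-nil  : Consecutive []
    cons-one  : ∀ {g} → Consecutive (g ∷ [])
    cons-step : ∀ {g h rest} → ShareOne g h → Consecutive (h ∷ rest) →
                Consecutive (g ∷ h ∷ rest)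

  Chain : List Edge → Set
  Chain C = (C ≢ []) × Unique C × Consecutive C

  shift' : Coloring → Edge → List Edge → Coloring
  shift' φ e [] g with g ≟ e
  ... | yes _ = nothing
  ... | no  _ = φ g
  shift' φ e (e' ∷ rest) g with g ≟ e
  ... | yes _ = φ e'
  ... | no  _ = shift' φ e' rest g

  shift : Coloring → List Edge → Coloring
  shift φ [] = φ
  shift φ (e ∷ rest) = shift' φ e rest

  Shiftable : ℕ → Coloring → List Edge → Set
  Shiftable r φ C = Chain C × (∃[ e₀ ] ∃[ rest ] (C ≡ e₀ ∷ rest × φ e₀ ≡ nothing))
                    × Proper (shift φ C)

  HappyEdge : ℕ → Coloring → Edge → Set
  HappyEdge r φ g = φ g ≡ nothing ×
    (∀ u w → EdgeBetween g u w → ∃[ c ] (Missing r φ u c × Missing r φ w c))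

  HappyChain : ℕ → Coloring → List Edge → Set
  HappyChain r φ C = Shiftable r φ C ×
    (∀ g → LastIs C g → HappyEdge r (shift φ C) g)

  HasColor2 : Coloring → Color → Color → Edge → Set
  HasColor2 φ α β g = φ g ≡ just α ⊎ φ g ≡ just β

  hasColor2? : ∀ φ α β g → Dec (HasColor2 φ α β g)
  hasColor2? φ α β g = MaybeP.≡-dec N._≟_ (φ g) (just α) ⊎-dec MaybeP.≡-dec N._≟_ (φ g) (just β)

  degK : Coloring → Color → Color → Vertex → ℕ
  degK φ α β v = length (filter (hasColor2? φ α β) (filter (isEnd? v) (allFin m)))

  data Related (φ : Coloring) (α β : Color) (u : Vertex) : Vertex → Set where
    rel-refl : Related φ α β u u
    rel-step : ∀ {w v g} → Related φ α β u w → HasColor2 φ α β g →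
               EdgeBetween g w v → Related φ α β u v

  SuccessfulEdge : Coloring → Color → Color → Edge → Set
  SuccessfulEdge φ α β g = φ g ≡ nothing ×
    (∀ u w → EdgeBetween g u w →
      degK φ α β u < 2 × degK φ α β w < 2 × ¬ Related φ α β u w)

  Fan : Vertex → List Edge → Set
  Fan x F = Chain F × All (IsEnd x) F

  VEnd : Vertex → List Edge → Vertex → Set
  VEnd x F y' = ∃[ g ] (LastIs F g × EdgeBetween g x y')

  HopefulFan : ℕ → Coloring → Vertex → List Edge → Color → Color → Set
  HopefulFan r φ x F α β = Fan x F × Shiftable r φ F × ¬ HappyChain r φ F ×
    (∀ y' → VEnd x F y' → degK φ α β x < 2 × degK φ α β y' < 2)

  SuccessfulFan : ℕ → Coloring → Vertex → List Edge → Color → Color → Set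
  SuccessfulFan r φ x F α β = HopefulFan r φ x F α β ×
    (∀ y' → VEnd x F y' → ¬ Related (shift φ F) α β x y')

  -- Output relation of the Next Shannon Fan procedure on (φ,e,x,α,β),
  -- y being the other endpoint of e.
  data NextShannonFan (r : ℕ) (φ : Coloring) (e : Edge) (x y : Vertex)
         (α β : Color) : List Edge → Color → Color → Set where
    nsf-1 : ∀ {δ} →
      IsMin (λ c → Missing r φ x c × Missing r φ y c) δ →
      NextShannonFan r φ e x y α β (e ∷ []) δ δ
    nsf-2 : ∀ {η f z δ} →
      (∀ c → ¬ (Missing r φ x c × Missing r φ y c)) →
      IsMin (λ c → Missing r φ y c × c ≢ β) η →
      IsEnd x f → φ f ≡ just η → EdgeBetween f x z →
      IsMin (λ c → Missing r φ x c × Missing r φ z c) δ →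
      NextShannonFan r φ e x y α β (e ∷ f ∷ []) δ δ
    nsf-3 : ∀ {η f z} →
      (∀ c → ¬ (Missing r φ x c × Missing r φ y c)) →
      IsMin (λ c → Missing r φ y c × c ≢ β) η →
      IsEnd x f → φ f ≡ just η → EdgeBetween f x z →
      (∀ c → ¬ (Missing r φ x c × Missing r φ z c)) →
      IsMin (λ c → Missing r φ y c × Missing r φ z c) β →
      NextShannonFan r φ e x y α β (e ∷ f ∷ []) α β
    nsf-4 : ∀ {η f z δ γ} →
      (∀ c → ¬ (Missing r φ x c × Missing r φ y c)) →
      IsMin (λ c → Missing r φ y c × c ≢ β) η →
      IsEnd x f → φ f ≡ just η → EdgeBetween f x z →
      (∀ c → ¬ (Missing r φ x c × Missing r φ z c)) →
      IsMin (λ c → Missing r φ y c × Missing r φ z c) δ → δ ≢ β →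
      IsMin (λ c → Missing r φ x c × c ≢ α) γ →
      NextShannonFan r φ e x y α β (e ∷ f ∷ []) γ δ

-- If x and the far end of the last fan edge share a missing color δ, then after
-- the shift the last edge joins two vertices missing δ, so the fan is happy.
-- Otherwise x misses γ and z misses δ, which bounds their degrees in G(φ,γδ);
-- that is all hopefulness needs. For success, y misses δ too, and the
-- γδ-component of x is a path starting at x (x has no γ-edge, and a proper
-- coloring puts at most one edge of each color at a vertex). That path has only
-- one end besides x, so it reaches at most one of y and z: either x and y are
-- unrelated, and e is successful, or x and z are, and since shifting (e, f) only
-- moves f's color η ∉ {γ, δ}, the fan is successful. No fan edge carries α, β, γ
-- or δ because each is missing at an end of that edge or excluded by the choice of η.

module Submission where

open import Defs
open import Data.Bool using (Bool; true; false; not)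
open import Data.Bool.Properties using (not-involutive)
open import Data.Empty using (⊥-elim)
open import Data.Fin using (Fin; toℕ; fromℕ<; _≟_)
import Data.Fin as Fin
open import Data.Fin.Properties using (pigeonhole; any?; toℕ<n; toℕ-fromℕ<; suc-injective; 2↔Bool; *↔×)
open import Data.List using (List; []; _∷_; length; allFin)
open import Data.List.Membership.Propositional using (_∈_)
open import Data.List.Membership.Propositional.Properties using (∈-filter⁻)
open import Data.List.Relation.Unary.Any using (here; there)
open import Data.List.Relation.Unary.All using ([]; _∷_)
import Data.List.Relation.Unary.All as All
open import Data.List.Relation.Unary.AllPairs using ([]; _∷_)
open import Data.List.Relation.Unary.Unique.Propositional using (Unique)
open import Data.List.Relation.Unary.Unique.Propositional.Properties using (filter⁺; allFin⁺)
open import Data.Maybe using (Maybe; just; nothing; _>>=_)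
import Data.Maybe.Properties as Maybe
open import Data.Nat using (ℕ; zero; suc; _+_; _∸_; _≤_; _<_; _*_; z≤n; s≤s)
import Data.Nat as ℕ
open import Data.Nat.Properties using (n<1+n; ≤-pred; m≤n⇒m<n∨m≡n; +-monoʳ-<; m∸n+n≡m; <-cmp)
open import Data.Product using (∃-syntax; _×_; _,_; proj₁; proj₂)
open import Data.Product.Function.NonDependent.Propositional using (_×-↔_)
open import Data.Sum using (_⊎_; inj₁; inj₂)
import Data.Sum as Sum
open import Function using (_∘_; case_of_)
open import Function.Bundles using (_↣_; Injection)
open import Function.Construct.Composition using (_↔-∘_)
open import Function.Construct.Identity using (↔-id)
open import Function.Properties.Inverse using (↔-sym; ↔⇒↣)
open import Relation.Nullary using (¬_; Dec; yes; no)
open import Relation.Nullary.Decidable using (_×-dec_; via-injection)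
open import Relation.Binary.PropositionalEquality
open import Relation.Binary.Definitions using (tri<; tri≈; tri>)

module Orbit {S : Set} {N : ℕ} (code : S ↣ Fin N) (step : S → Maybe S) (s₀ : S) where
  open Injection code using (to; injective)

  orbit : ℕ → Maybe S
  orbit zero    = just s₀
  orbit (suc k) = orbit k >>= step

  orbit-shift : ∀ {i j} → orbit i ≡ orbit j → ∀ d → orbit (d + i) ≡ orbit (d + j)
  orbit-shift eq zero    = eq
  orbit-shift eq (suc d) = cong (_>>= step) (orbit-shift eq d)

  orbit-halts : ∀ {i} l → orbit i ≡ nothing → i ≤ l → orbit l ≡ nothing
  orbit-halts l halted i≤l with m≤n⇒m<n∨m≡n i≤l
  ... | inj₂ refl = halted
  orbit-halts (suc l) halted _ | inj₁ (s≤s i≤l) = cong (_>>= step) (orbit-halts l halted i≤l)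

  orbit-halts-at : ∀ {i l s} → orbit i ≡ nothing → i ≤ l → orbit l ≢ just s
  orbit-halts-at {l = l} halted i≤l eq with trans (sym (orbit-halts l halted i≤l)) eq
  ... | ()

  private
    codeMaybe : Maybe S → Fin (suc N)
    codeMaybe nothing  = Fin.zero
    codeMaybe (just s) = Fin.suc (to s)

    codeMaybe-injective : ∀ {m m′} → codeMaybe m ≡ codeMaybe m′ → m ≡ m′
    codeMaybe-injective {nothing} {nothing} _  = refl
    codeMaybe-injective {just s}  {just s′} eq = cong just (injective (suc-injective eq))

  -- Pigeonhole: two of orbit 0, …, orbit (N + 1) coincide, and the orbit repeats from there.
  orbit-returns : ∃[ i ] (i ≤ N × orbit (suc N) ≡ orbit i)
  orbit-returns with pigeonhole (n<1+n (suc N)) (codeMaybe ∘ orbit ∘ toℕ)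
  ... | i , j , i<j , same = d + toℕ i , ≤-pred (subst (d + toℕ i <_) d+j≡1+N (+-monoʳ-< d i<j)) ,
        trans (sym (cong orbit d+j≡1+N)) (sym (orbit-shift (codeMaybe-injective same) d))
    where
      d = suc N ∸ toℕ j
      d+j≡1+N : d + toℕ j ≡ suc N
      d+j≡1+N = m∸n+n≡m (≤-pred (toℕ<n j))

  orbit-recurs : ∀ k → ∃[ i ] (i ≤ N × orbit k ≡ orbit i)
  orbit-recurs zero = zero , z≤n , refl
  orbit-recurs (suc k) with orbit-recurs k
  ... | i , i≤N , eq with m≤n⇒m<n∨m≡n i≤N
  ...   | inj₁ i<N  = suc i , i<N , cong (_>>= step) eq
  ...   | inj₂ refl with orbit-returns
  ...     | j , j≤N , eq′ = j , j≤N , trans (cong (_>>= step) eq) eq′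

  reaches? : (t : S) → Dec (∃[ k ] orbit k ≡ just t)
  reaches? t with any? (λ (i : Fin (suc N)) → Maybe.≡-dec (via-injection code _≟_) (orbit (toℕ i)) (just t))
  ... | yes (i , eq) = yes (toℕ i , eq)
  ... | no ¬early    = no λ (k , eq) → let (i , i≤N , eq′) = orbit-recurs k in
        ¬early (fromℕ< (s≤s i≤N) , trans (cong orbit (toℕ-fromℕ< (s≤s i≤N))) (trans (sym eq′) eq))

unique-subsingleton⇒length<2 : ∀ {A : Set} {xs : List A} → Unique xs →
                               (∀ {p q} → p ∈ xs → q ∈ xs → p ≡ q) → length xs < 2
unique-subsingleton⇒length<2 {xs = []}        _               _    = s≤s z≤n
unique-subsingleton⇒length<2 {xs = _ ∷ []}    _               _    = s≤s (s≤s z≤n)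
unique-subsingleton⇒length<2 {xs = _ ∷ _ ∷ _} ((p≢q ∷ _) ∷ _) same =
  ⊥-elim (p≢q (same (here refl) (there (here refl))))

module _ {G : Multigraph} where
  open Multigraph G using (m; ends; loopless)

  between⇒isEndˡ : ∀ {g u w} → EdgeBetween G g u w → IsEnd G u g
  between⇒isEndˡ (inj₁ p) = inj₁ (cong proj₁ p)
  between⇒isEndˡ (inj₂ p) = inj₂ (cong proj₂ p)

  between⇒isEndʳ : ∀ {g u w} → EdgeBetween G g u w → IsEnd G w g
  between⇒isEndʳ (inj₁ p) = inj₂ (cong proj₂ p)
  between⇒isEndʳ (inj₂ p) = inj₁ (cong proj₁ p)

  between-sym : ∀ {g u w} → EdgeBetween G g u w → EdgeBetween G g w u
  between-sym (inj₁ p) = inj₂ p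
  between-sym (inj₂ p) = inj₁ p

  between-distinct : ∀ {g u w} → EdgeBetween G g u w → u ≢ w
  between-distinct {g} (inj₁ p) u≡w = loopless g (trans (cong proj₁ p) (trans u≡w (sym (cong proj₂ p))))
  between-distinct {g} (inj₂ p) u≡w = loopless g (trans (cong proj₁ p) (trans (sym u≡w) (sym (cong proj₂ p))))

  isEnd-between : ∀ {g u w v} → EdgeBetween G g u w → IsEnd G v g → v ≡ u ⊎ v ≡ w
  isEnd-between (inj₁ p) (inj₁ q) = inj₁ (trans (sym q) (cong proj₁ p))
  isEnd-between (inj₁ p) (inj₂ q) = inj₂ (trans (sym q) (cong proj₂ p))
  isEnd-between (inj₂ p) (inj₁ q) = inj₂ (trans (sym q) (cong proj₁ p))
  isEnd-between (inj₂ p) (inj₂ q) = inj₁ (trans (sym q) (cong proj₂ p))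

  between-unique : ∀ {g u w w′} → EdgeBetween G g u w → EdgeBetween G g u w′ → w ≡ w′
  between-unique g[u,w] g[u,w′] with isEnd-between g[u,w′] (between⇒isEndʳ g[u,w])
  ... | inj₁ w≡u  = ⊥-elim (between-distinct g[u,w] (sym w≡u))
  ... | inj₂ w≡w′ = w≡w′

  between-cases : ∀ {g x y u w} → EdgeBetween G g x y → EdgeBetween G g u w →
                  (u ≡ x × w ≡ y) ⊎ (u ≡ y × w ≡ x)
  between-cases g[x,y] g[u,w] with isEnd-between g[x,y] (between⇒isEndˡ g[u,w])
  ... | inj₁ refl = inj₁ (refl , between-unique g[u,w] g[x,y])
  ... | inj₂ refl = inj₂ (refl , between-unique g[u,w] (between-sym g[x,y]))

  sameEnds-isEnd : ∀ {g h v} → SameEnds G g h → IsEnd G v g → IsEnd G v h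
  sameEnds-isEnd (inj₁ p) (inj₁ q) = inj₁ (trans (sym (cong proj₁ p)) q)
  sameEnds-isEnd (inj₁ p) (inj₂ q) = inj₂ (trans (sym (cong proj₂ p)) q)
  sameEnds-isEnd (inj₂ p) (inj₁ q) = inj₂ (trans (sym (cong proj₁ p)) q)
  sameEnds-isEnd (inj₂ p) (inj₂ q) = inj₁ (trans (sym (cong proj₂ p)) q)

  opposite : Edge G → Vertex G → Vertex G
  opposite g v with proj₁ (ends g) ≟ v
  ... | yes _ = proj₂ (ends g)
  ... | no  _ = proj₁ (ends g)

  opposite-between : ∀ {g v} → IsEnd G v g → EdgeBetween G g v (opposite g v)
  opposite-between {g} {v} v∈g with proj₁ (ends g) ≟ v | v∈g
  ... | yes p | _      = inj₁ (cong (_, proj₂ (ends g)) p)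
  ... | no ¬p | inj₁ p = ⊥-elim (¬p p)
  ... | no _  | inj₂ p = inj₂ (cong (proj₁ (ends g) ,_) p)

  Lacks : Coloring G → Vertex G → Color → Set
  Lacks φ v c = ∀ g → IsEnd G v g → φ g ≢ just c

  missing⇒lacks : ∀ {r φ v c} → Missing G r φ v c → Lacks φ v c
  missing⇒lacks (_ , _ , lacks) = lacks

  missing-transfer : ∀ {r φ ψ v c} → (∀ g → IsEnd G v g → ψ g ≡ just c → φ g ≡ just c) →
                     Missing G r φ v c → Missing G r ψ v c
  missing-transfer ψ⇒φ (1≤c , c≤r , lacks) =
    1≤c , c≤r , λ g v∈g ψg≡c → lacks g v∈g (ψ⇒φ g v∈g ψg≡c)

  proper-unique : ∀ {φ v g h c} → Proper G φ → IsEnd G v g → IsEnd G v h →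
                  φ g ≡ just c → φ h ≡ just c → g ≡ h
  proper-unique {g = g} {h} proper v∈g v∈h φg≡c φh≡c with g ≟ h
  ... | yes g≡h = g≡h
  ... | no  g≢h = ⊥-elim (proper g h _ (g≢h , _ , v∈g , v∈h) φg≡c φh≡c)

  proper-≗ : ∀ {φ ψ} → (∀ g → ψ g ≡ φ g) → Proper G φ → Proper G ψ
  proper-≗ ψ≗φ proper g h c adj ψg≡c ψh≡c =
    proper g h c adj (trans (sym (ψ≗φ g)) ψg≡c) (trans (sym (ψ≗φ h)) ψh≡c)

  module _ {φ : Coloring G} (proper : Proper G φ) {a b : Color} where

    degK<2 : ∀ {v} d → (∀ g → IsEnd G v g → HasColor2 G φ a b g → φ g ≡ just d) → degK G φ a b v < 2
    degK<2 {v} d monochrome = unique-subsingleton⇒length<2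
      (filter⁺ (hasColor2? G φ a b) (filter⁺ (isEnd? G v) (allFin⁺ m)))
      λ p∈ q∈ → let (p∈′ , p-ab) = ∈-filter⁻ (hasColor2? G φ a b) p∈
                    (q∈′ , q-ab) = ∈-filter⁻ (hasColor2? G φ a b) q∈
                    v∈p = proj₂ (∈-filter⁻ (isEnd? G v) {xs = allFin m} p∈′)
                    v∈q = proj₂ (∈-filter⁻ (isEnd? G v) {xs = allFin m} q∈′)
                in proper-unique proper v∈p v∈q (monochrome _ v∈p p-ab) (monochrome _ v∈q q-ab)

    lacksˡ⇒degK<2 : ∀ {v} → Lacks φ v a → degK G φ a b v < 2
    lacksˡ⇒degK<2 lacks = degK<2 b λ
      { g v∈g (inj₁ φg≡a) → ⊥-elim (lacks g v∈g φg≡a)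
      ; g v∈g (inj₂ φg≡b) → φg≡b }

    lacksʳ⇒degK<2 : ∀ {v} → Lacks φ v b → degK G φ a b v < 2
    lacksʳ⇒degK<2 lacks = degK<2 a λ
      { g v∈g (inj₁ φg≡a) → φg≡a
      ; g v∈g (inj₂ φg≡b) → ⊥-elim (lacks g v∈g φg≡b) }

  module _ {φ : Coloring G} {a b : Color} where

    related-prepend : ∀ {g u v w} → EdgeBetween G g v u → HasColor2 G φ a b g →
                      Related G φ a b u w → Related G φ a b v w
    related-prepend g[v,u] g-ab rel-refl                  = rel-step rel-refl g-ab g[v,u]
    related-prepend g[v,u] g-ab (rel-step R h-ab h[w′,w]) = rel-step (related-prepend g[v,u] g-ab R) h-ab h[w′,w]

    related-sym : ∀ {u v} → Related G φ a b u v → Related G φ a b v u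
    related-sym rel-refl                 = rel-refl
    related-sym (rel-step R g-ab g[w,v]) = related-prepend (between-sym g[w,v]) g-ab (related-sym R)

  -- Since x lacks a and φ is proper, the component of x in G(φ,ab) is a path
  -- leaving x along its b-edge; the walk below traces it, recording in the Bool
  -- whether the next edge to follow is colored b (true) or a (false).
  module KempeWalk {φ : Coloring G} (proper : Proper G φ) (a b : Color)
                   {x : Vertex G} (x-lacks-a : Lacks φ x a) where
    open Multigraph G using (n)

    color : Bool → Color
    color true  = b
    color false = a

    color-ab : ∀ {g} t → φ g ≡ just (color t) → HasColor2 G φ a b g
    color-ab true  = inj₂
    color-ab false = inj₁

    ab-color : ∀ {g} t → HasColor2 G φ a b g → φ g ≡ just (color t) ⊎ φ g ≡ just (color (not t))
    ab-color true  (inj₁ φg≡a) = inj₂ φg≡a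
    ab-color true  (inj₂ φg≡b) = inj₁ φg≡b
    ab-color false (inj₁ φg≡a) = inj₁ φg≡a
    ab-color false (inj₂ φg≡b) = inj₂ φg≡b

    edge? : ∀ v c → Dec (∃[ g ] (IsEnd G v g × φ g ≡ just c))
    edge? v c = any? λ g → isEnd? G v g ×-dec Maybe.≡-dec ℕ._≟_ (φ g) (just c)

    step : Vertex G × Bool → Maybe (Vertex G × Bool)
    step (v , t) with edge? v (color t)
    ... | yes (g , _ , _) = just (opposite g v , not t)
    ... | no  _           = nothing

    stateCode : (Vertex G × Bool) ↣ Fin (n * 2)
    stateCode = ↔⇒↣ (↔-sym ((↔-id _ ×-↔ 2↔Bool) ↔-∘ *↔×))

    open Orbit stateCode step (x , true)

    Visited : Vertex G → Set
    Visited v = ∃[ k ] ∃[ t ] orbit k ≡ just (v , t)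

    orbit⇒related : ∀ k {v t} → orbit k ≡ just (v , t) → Related G φ a b x v
    orbit⇒related zero    refl = rel-refl
    orbit⇒related (suc k) eq with orbit k in eqₖ
    ... | just (w , t) with edge? w (color t) | eq
    ...   | yes (g , w∈g , φg≡c) | refl =
            rel-step (orbit⇒related k eqₖ) (color-ab t φg≡c) (opposite-between w∈g)

    orbit-previous : ∀ k {w t} → orbit (suc k) ≡ just (w , t) →
      ∃[ w₀ ] ∃[ t₀ ] ∃[ g₀ ] (orbit k ≡ just (w₀ , t₀) × t ≡ not t₀ ×
                               EdgeBetween G g₀ w₀ w × φ g₀ ≡ just (color t₀))
    orbit-previous k eq with orbit k in eqₖ
    ... | just (w₀ , t₀) with edge? w₀ (color t₀) | eq
    ...   | yes (g , w₀∈g , φg≡c) | refl = w₀ , t₀ , g , refl , refl , opposite-between w₀∈g , φg≡c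

    orbit-forward : ∀ k {w t g v} → orbit k ≡ just (w , t) → φ g ≡ just (color t) →
                    EdgeBetween G g w v → orbit (suc k) ≡ just (v , not t)
    orbit-forward k {w} {t} eqₖ φg≡c g[w,v] rewrite eqₖ with edge? w (color t)
    ... | no ∄g = ⊥-elim (∄g (_ , between⇒isEndˡ g[w,v] , φg≡c))
    ... | yes (g′ , w∈g′ , φg′≡c) with proper-unique proper w∈g′ (between⇒isEndˡ g[w,v]) φg′≡c φg≡c
    ...   | refl = cong (λ u → just (u , not t)) (between-unique (opposite-between w∈g′) g[w,v])

    -- an edge of the other color at a visited vertex is the one the walk arrived by
    orbit-backward : ∀ k {w t g v} → orbit k ≡ just (w , t) → φ g ≡ just (color (not t)) →
                     EdgeBetween G g w v → Visited v
    orbit-backward zero    refl φg≡a g[x,v] = ⊥-elim (x-lacks-a _ (between⇒isEndˡ g[x,v]) φg≡a)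
    orbit-backward (suc k) eq φg≡c g[w,v] with orbit-previous k eq
    ... | w₀ , t₀ , g₀ , eqₖ , refl , g₀[w₀,w] , φg₀≡c
      with proper-unique proper (between⇒isEndˡ g[w,v]) (between⇒isEndʳ g₀[w₀,w])
             (trans φg≡c (cong (just ∘ color) (not-involutive t₀))) φg₀≡c
    ... | refl = k , t₀ , subst (λ u → orbit k ≡ just (u , t₀))
                                (between-unique (between-sym g₀[w₀,w]) g[w,v]) eqₖ

    related⇒visited : ∀ {v} → Related G φ a b x v → Visited v
    related⇒visited rel-refl = zero , true , refl
    related⇒visited (rel-step R g-ab g[w,v]) with related⇒visited R
    ... | k , t , eqₖ with ab-color t g-ab
    ...   | inj₁ φg≡c = suc k , not t , orbit-forward k eqₖ φg≡c g[w,v]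
    ...   | inj₂ φg≡c = orbit-backward k eqₖ φg≡c g[w,v]

    related? : ∀ v → Dec (Related G φ a b x v)
    related? v with reaches? (v , true) | reaches? (v , false)
    ... | yes (k , eq) | _            = yes (orbit⇒related k eq)
    ... | no _         | yes (k , eq) = yes (orbit⇒related k eq)
    ... | no ¬true     | no ¬false    = no λ R → case related⇒visited R of λ
          { (k , true  , eq) → ¬true  (k , eq)
          ; (k , false , eq) → ¬false (k , eq) }

    orbit-stops : ∀ k {w t} → Lacks φ w b → w ≢ x → orbit k ≡ just (w , t) → orbit (suc k) ≡ nothing
    orbit-stops zero    _         w≢x refl = ⊥-elim (w≢x refl)
    orbit-stops (suc k) {w} w-lacks-b _ eq with orbit-previous k eq
    ... | _ , true  , g₀ , _ , refl , g₀[w₀,w] , φg₀≡b =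
            ⊥-elim (w-lacks-b g₀ (between⇒isEndʳ g₀[w₀,w]) φg₀≡b)
    ... | _ , false , _  , _ , refl , _ , _ rewrite eq with edge? w b
    ...   | yes (g , w∈g , φg≡b) = ⊥-elim (w-lacks-b g w∈g φg≡b)
    ...   | no  _                = refl

    -- the walk stops at the first vertex other than x that lacks b
    kempe-end-unique : ∀ {y z} → Lacks φ y b → Lacks φ z b → y ≢ x → z ≢ x →
                       Related G φ a b x y → Related G φ a b x z → y ≡ z
    kempe-end-unique y-lacks z-lacks y≢x z≢x Ry Rz
      with related⇒visited Ry | related⇒visited Rz
    ... | k , _ , eqʸ | j , _ , eqᶻ with <-cmp k j
    ...   | tri< k<j _ _  = ⊥-elim (orbit-halts-at (orbit-stops k y-lacks y≢x eqʸ) k<j eqᶻ)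
    ...   | tri> _ _ j<k  = ⊥-elim (orbit-halts-at (orbit-stops j z-lacks z≢x eqᶻ) j<k eqʸ)
    ...   | tri≈ _ refl _ = cong proj₁ (Maybe.just-injective (trans (sym eqʸ) eqᶻ))

  shift-single : ∀ {φ e} → φ e ≡ nothing → ∀ g → shift G φ (e ∷ []) g ≡ φ g
  shift-single {e = e} φe≡∅ g with g ≟ e
  ... | yes refl = sym φe≡∅
  ... | no  _    = refl

  shift-pair-first : ∀ {φ e f} → shift G φ (e ∷ f ∷ []) e ≡ φ f
  shift-pair-first {e = e} with e ≟ e
  ... | yes _   = refl
  ... | no  e≢e = ⊥-elim (e≢e refl)

  shift-pair-last : ∀ {φ e f} → f ≢ e → shift G φ (e ∷ f ∷ []) f ≡ nothing
  shift-pair-last {e = e} {f} f≢e with f ≟ e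
  ... | yes f≡e = ⊥-elim (f≢e f≡e)
  ... | no  _   with f ≟ f
  ...   | yes _   = refl
  ...   | no  f≢f = ⊥-elim (f≢f refl)

  shift-pair-other : ∀ {φ e f g} → g ≢ e → g ≢ f → shift G φ (e ∷ f ∷ []) g ≡ φ g
  shift-pair-other {e = e} {f} {g} g≢e g≢f with g ≟ e
  ... | yes g≡e = ⊥-elim (g≢e g≡e)
  ... | no  _   with g ≟ f
  ...   | yes g≡f = ⊥-elim (g≢f g≡f)
  ...   | no  _   = refl

  shared-missing : ∀ {r ψ g x y c} → EdgeBetween G g x y → Missing G r ψ x c → Missing G r ψ y c →
                   ∀ u w → EdgeBetween G g u w → ∃[ c ] (Missing G r ψ u c × Missing G r ψ w c)
  shared-missing {c = c} g[x,y] c∈Mx c∈My u w g[u,w] with between-cases g[x,y] g[u,w]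
  ... | inj₁ (refl , refl) = c , c∈Mx , c∈My
  ... | inj₂ (refl , refl) = c , c∈My , c∈Mx

  lastIs-pair : ∀ {e f g : Edge G} → LastIs (e ∷ f ∷ []) g → g ≡ f
  lastIs-pair (last-cons last-one) = refl

  module UncoloredEdge {r : ℕ} {φ : Coloring G} (proper : Proper G φ) {e : Edge G} (φe≡∅ : φ e ≡ nothing)
                       {x y : Vertex G} (e[x,y] : EdgeBetween G e x y) where

    y≢x : y ≢ x
    y≢x = between-distinct e[x,y] ∘ sym

    single-happy : ∀ {c} → Missing G r φ x c → Missing G r φ y c → HappyChain G r φ (e ∷ [])
    single-happy c∈Mx c∈My =
      (((λ ()) , [] ∷ [] , cons-one) , (e , [] , refl , φe≡∅) , proper-≗ (shift-single φe≡∅) proper) ,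
      λ { g last-one → trans (shift-single φe≡∅ e) φe≡∅ ,
                       shared-missing e[x,y] (unshift c∈Mx) (unshift c∈My) }
      where
        unshift : ∀ {v c} → Missing G r φ v c → Missing G r (shift G φ (e ∷ [])) v c
        unshift = missing-transfer λ g _ ψg≡c → trans (sym (shift-single φe≡∅ g)) ψg≡c

    successful-edge : ∀ {a b} → degK G φ a b x < 2 → degK G φ a b y < 2 → ¬ Related G φ a b x y →
                      SuccessfulEdge G φ a b e
    successful-edge degx degy x≁y = φe≡∅ , λ u w e[u,w] → case between-cases e[x,y] e[u,w] of λ
      { (inj₁ (refl , refl)) → degx , degy , x≁y
      ; (inj₂ (refl , refl)) → degy , degx , x≁y ∘ related-sym }

    module Fan₂ {f : Edge G} {z : Vertex G} {η : Color} (φf≡η : φ f ≡ just η)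
                (f[x,z] : EdgeBetween G f x z) (y-lacks-η : Lacks φ y η) where

      shifted : Coloring G
      shifted = shift G φ (e ∷ f ∷ [])

      x∈f : IsEnd G x f
      x∈f = between⇒isEndˡ f[x,z]

      f≢e : f ≢ e
      f≢e refl with trans (sym φf≡η) φe≡∅
      ... | ()

      y∉f : ¬ IsEnd G y f
      y∉f y∈f = y-lacks-η f y∈f φf≡η

      z≢x : z ≢ x
      z≢x z≡x = between-distinct f[x,z] (sym z≡x)

      z≢y : z ≢ y
      z≢y refl = y∉f (between⇒isEndʳ f[x,z])

      missing-on-f⇒≢η : ∀ {v c} → IsEnd G v f → Missing G r φ v c → c ≢ η
      missing-on-f⇒≢η v∈f c∈Mv refl = missing⇒lacks c∈Mv f v∈f φf≡η

      fan₂ : Fan G x (e ∷ f ∷ [])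
      fan₂ = ((λ ()) , ((f≢e ∘ sym) ∷ []) ∷ [] ∷ [] , cons-step (share-x , not-parallel) cons-one) ,
             between⇒isEndˡ e[x,y] ∷ x∈f ∷ []
        where
          share-x = x , between⇒isEndˡ e[x,y] , x∈f
          not-parallel = λ same → y∉f (sameEnds-isEnd same (between⇒isEndʳ e[x,y]))

      shifted-colored : ∀ {g c} → shifted g ≡ just c → (g ≡ e × c ≡ η) ⊎ (g ≢ f × φ g ≡ just c)
      shifted-colored {g} sg≡c with g ≟ e
      ... | yes refl = inj₁ (refl , Maybe.just-injective (trans (sym sg≡c) φf≡η))
      ... | no _ with g ≟ f
      ...   | no g≢f = inj₂ (g≢f , sg≡c)
      shifted-colored () | no _ | yes _

      -- At x only f has color η, and y lacks it, so e can take it over.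
      η-only-on-f-near-e : ∀ {v h} → IsEnd G v e → IsEnd G v h → h ≢ f → φ h ≢ just η
      η-only-on-f-near-e v∈e v∈h h≢f φh≡η with isEnd-between e[x,y] v∈e
      ... | inj₁ refl = h≢f (proper-unique proper v∈h x∈f φh≡η φf≡η)
      ... | inj₂ refl = y-lacks-η _ v∈h φh≡η

      shifted-proper : Proper G shifted
      shifted-proper g h c (g≢h , v , v∈g , v∈h) sg≡c sh≡c
        with shifted-colored {g} sg≡c | shifted-colored {h} sh≡c
      ... | inj₁ (refl , refl)  | inj₁ (refl , _)     = g≢h refl
      ... | inj₁ (refl , refl)  | inj₂ (h≢f , φh≡η)  = η-only-on-f-near-e v∈g v∈h h≢f φh≡η
      ... | inj₂ (g≢f , φg≡η)  | inj₁ (refl , refl)  = η-only-on-f-near-e v∈h v∈g g≢f φg≡η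
      ... | inj₂ (_ , φg≡c)    | inj₂ (_ , φh≡c)     = proper g h c (g≢h , v , v∈g , v∈h) φg≡c φh≡c

      shifted⇒φ : ∀ {g c} → c ≢ η → shifted g ≡ just c → φ g ≡ just c
      shifted⇒φ {g} c≢η sg≡c with shifted-colored {g} sg≡c
      ... | inj₁ (_ , c≡η)       = ⊥-elim (c≢η c≡η)
      ... | inj₂ (_ , φg≡c)     = φg≡c

      φ⇒shifted : ∀ {g c} → c ≢ η → φ g ≡ just c → shifted g ≡ just c
      φ⇒shifted {g} c≢η φg≡c = trans (shift-pair-other g≢e g≢f) φg≡c
        where
          g≢e : g ≢ e
          g≢e refl with trans (sym φe≡∅) φg≡c
          ... | ()
          g≢f : g ≢ f
          g≢f refl = c≢η (Maybe.just-injective (trans (sym φg≡c) φf≡η))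

      fan₂-shiftable : Shiftable G r φ (e ∷ f ∷ [])
      fan₂-shiftable = proj₁ fan₂ , (e , f ∷ [] , refl , φe≡∅) , shifted-proper

      fan₂-happy : ∀ {c} → Missing G r φ x c → Missing G r φ z c → HappyChain G r φ (e ∷ f ∷ [])
      fan₂-happy {c} c∈Mx c∈Mz = fan₂-shiftable , λ g last → case lastIs-pair last of λ
        { refl → shift-pair-last f≢e , shared-missing f[x,z] (shift-missing c∈Mx) (shift-missing c∈Mz) }
        where
          shift-missing : ∀ {v} → Missing G r φ v c → Missing G r shifted v c
          shift-missing = missing-transfer λ _ _ → shifted⇒φ (missing-on-f⇒≢η x∈f c∈Mx)

      fan₂-unhappy : (∀ c → ¬ (Missing G r φ x c × Missing G r φ z c)) →
                     ¬ HappyChain G r φ (e ∷ f ∷ [])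
      fan₂-unhappy no-common (_ , happy) with proj₂ (happy f (last-cons last-one)) x z f[x,z]
      ... | c , c∈Mx , c∈Mz = no-common c (unshift-missing c∈Mx , unshift-missing c∈Mz)
        where
          -- in the shifted coloring e carries η at x
          c≢η : c ≢ η
          c≢η refl = missing⇒lacks c∈Mx e (between⇒isEndˡ e[x,y])
                                     (trans (shift-pair-first {φ = φ} {e} {f}) φf≡η)
          unshift-missing : ∀ {v} → Missing G r shifted v c → Missing G r φ v c
          unshift-missing = missing-transfer λ _ _ → φ⇒shifted c≢η

      vEnd≡z : ∀ {y′} → VEnd G x (e ∷ f ∷ []) y′ → y′ ≡ z
      vEnd≡z (g , last , g[x,y′]) with lastIs-pair last
      ... | refl = between-unique g[x,y′] f[x,z]

      fan₂-hopeful : ∀ {a b} → ¬ HappyChain G r φ (e ∷ f ∷ []) →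
                     degK G φ a b x < 2 → degK G φ a b z < 2 → HopefulFan G r φ x (e ∷ f ∷ []) a b
      fan₂-hopeful {a} {b} unhappy degx degz = fan₂ , fan₂-shiftable , unhappy ,
        λ _ vEnd → degx , subst (λ v → degK G φ a b v < 2) (sym (vEnd≡z vEnd)) degz

      related-shifted⇒related : ∀ {a b u v} → a ≢ η → b ≢ η →
                                Related G shifted a b u v → Related G φ a b u v
      related-shifted⇒related a≢η b≢η rel-refl = rel-refl
      related-shifted⇒related a≢η b≢η (rel-step R g-ab g[w,v]) =
        rel-step (related-shifted⇒related a≢η b≢η R)
                 (Sum.map (shifted⇒φ a≢η) (shifted⇒φ b≢η) g-ab) g[w,v]

      fan₂-successful : ∀ {a b} → ¬ HappyChain G r φ (e ∷ f ∷ []) →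
                        degK G φ a b x < 2 → degK G φ a b z < 2 → a ≢ η → b ≢ η →
                        ¬ Related G φ a b x z → SuccessfulFan G r φ x (e ∷ f ∷ []) a b
      fan₂-successful {a} {b} unhappy degx degz a≢η b≢η x≁z = fan₂-hopeful unhappy degx degz ,
        λ _ vEnd R → x≁z (subst (Related G φ a b x) (vEnd≡z vEnd) (related-shifted⇒related a≢η b≢η R))

      -- Both y and z lack b while x lacks a; the a/b-path starting at x has only
      -- one end besides x, so it cannot reach both y and z.
      fan₂-or-edge-successful : ∀ {a b} → Missing G r φ x a → Missing G r φ y b → Missing G r φ z b →
                                ¬ HappyChain G r φ (e ∷ f ∷ []) →
                                SuccessfulFan G r φ x (e ∷ f ∷ []) a b ⊎ SuccessfulEdge G φ a b e
      fan₂-or-edge-successful {a} {b} a∈Mx b∈My b∈Mz unhappy = decide (related? y)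
        where
          open KempeWalk proper a b (missing⇒lacks a∈Mx)
          degx = lacksˡ⇒degK<2 proper (missing⇒lacks a∈Mx)
          decide : Dec (Related G φ a b x y) →
                   SuccessfulFan G r φ x (e ∷ f ∷ []) a b ⊎ SuccessfulEdge G φ a b e
          decide (yes x~y) = inj₁ (fan₂-successful unhappy degx (lacksʳ⇒degK<2 proper (missing⇒lacks b∈Mz))
            (missing-on-f⇒≢η x∈f a∈Mx) (missing-on-f⇒≢η (between⇒isEndʳ f[x,z]) b∈Mz)
            λ x~z → z≢y (sym (kempe-end-unique (missing⇒lacks b∈My) (missing⇒lacks b∈Mz)
                                                y≢x z≢x x~y x~z)))
          decide (no x≁y) = inj₂ (successful-edge degx (lacksʳ⇒degK<2 proper (missing⇒lacks b∈My)) x≁y)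

  module ShannonFan {r : ℕ} {φ : Coloring G} (proper : Proper G φ) {e : Edge G} (φe≡∅ : φ e ≡ nothing)
                    {x y : Vertex G} (e[x,y] : EdgeBetween G e x y)
                    {α β : Color} (α∈Mx : Missing G r φ x α) where
    open UncoloredEdge {r = r} proper φe≡∅ e[x,y]

    AvoidsColors : List (Edge G) → Color → Color → Set
    AvoidsColors F γ δ =
      (g : Edge G) → g ∈ F → φ g ≢ just α × φ g ≢ just β × φ g ≢ just γ × φ g ≢ just δ

    Outcome : List (Edge G) → Color → Color → Set
    Outcome F γ δ =
      (Missing G r φ x δ × HappyChain G r φ F)
      ⊎ (length F ≡ 2 × δ ≡ β × HopefulFan G r φ x F α β)
      ⊎ (length F ≡ 2 × δ ≢ β × SuccessfulFan G r φ x F γ δ)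
      ⊎ (δ ≢ β × SuccessfulEdge G φ γ δ e)

    e-uncolored : ∀ {c} → φ e ≢ just c
    e-uncolored φe≡c with trans (sym φe≡∅) φe≡c
    ... | ()

    color-≢ : ∀ {g c d} → φ g ≡ just c → c ≢ d → φ g ≢ just d
    color-≢ φg≡c c≢d φg≡d = c≢d (Maybe.just-injective (trans (sym φg≡c) φg≡d))

    pair-avoids : ∀ {f γ δ} → φ f ≢ just α → φ f ≢ just β → φ f ≢ just γ → φ f ≢ just δ →
                  AvoidsColors (e ∷ f ∷ []) γ δ
    pair-avoids f≢α f≢β f≢γ f≢δ _ =
      All.lookup ((e-uncolored , e-uncolored , e-uncolored , e-uncolored) ∷ (f≢α , f≢β , f≢γ , f≢δ) ∷ [])

    nsf-avoids : ∀ {F γ δ} → NextShannonFan G r φ e x y α β F γ δ → AvoidsColors F γ δ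
    nsf-avoids (nsf-1 _) _ =
      All.lookup ((e-uncolored , e-uncolored , e-uncolored , e-uncolored) ∷ [])
    nsf-avoids (nsf-2 _ ((_ , η≢β) , _) _ φf≡η f[x,z] ((δ∈Mx , _) , _)) =
      pair-avoids (missing⇒lacks α∈Mx _ x∈f) (color-≢ φf≡η η≢β)
                  (missing⇒lacks δ∈Mx _ x∈f) (missing⇒lacks δ∈Mx _ x∈f)
      where x∈f = between⇒isEndˡ f[x,z]
    nsf-avoids (nsf-3 _ ((_ , η≢β) , _) _ φf≡η f[x,z] _ _) =
      pair-avoids (missing⇒lacks α∈Mx _ x∈f) (color-≢ φf≡η η≢β)
                  (missing⇒lacks α∈Mx _ x∈f) (color-≢ φf≡η η≢β)
      where x∈f = between⇒isEndˡ f[x,z]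
    nsf-avoids (nsf-4 _ ((_ , η≢β) , _) _ φf≡η f[x,z] _ ((_ , δ∈Mz) , _) _ ((γ∈Mx , _) , _)) =
      pair-avoids (missing⇒lacks α∈Mx _ x∈f) (color-≢ φf≡η η≢β)
                  (missing⇒lacks γ∈Mx _ x∈f) (missing⇒lacks δ∈Mz _ z∈f)
      where x∈f = between⇒isEndˡ f[x,z]
            z∈f = between⇒isEndʳ f[x,z]

    nsf-outcome : ∀ {F γ δ} → NextShannonFan G r φ e x y α β F γ δ → Outcome F γ δ
    nsf-outcome (nsf-1 ((δ∈Mx , δ∈My) , _)) = inj₁ (δ∈Mx , single-happy δ∈Mx δ∈My)
    nsf-outcome (nsf-2 _ ((η∈My , _) , _) _ φf≡η f[x,z] ((δ∈Mx , δ∈Mz) , _)) =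
      inj₁ (δ∈Mx , fan₂-happy δ∈Mx δ∈Mz)
      where open Fan₂ φf≡η f[x,z] (missing⇒lacks η∈My)
    nsf-outcome (nsf-3 _ ((η∈My , _) , _) _ φf≡η f[x,z] no-common ((_ , β∈Mz) , _)) =
      inj₂ (inj₁ (refl , refl , fan₂-hopeful (fan₂-unhappy no-common)
                                  (lacksˡ⇒degK<2 proper (missing⇒lacks α∈Mx))
                                  (lacksʳ⇒degK<2 proper (missing⇒lacks β∈Mz))))
      where open Fan₂ φf≡η f[x,z] (missing⇒lacks η∈My)
    nsf-outcome (nsf-4 _ ((η∈My , _) , _) _ φf≡η f[x,z] no-common ((δ∈My , δ∈Mz) , _) δ≢β
                       ((γ∈Mx , _) , _)) =
      inj₂ (inj₂ (Sum.map (λ fan-ok → refl , δ≢β , fan-ok) (δ≢β ,_)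
                   (fan₂-or-edge-successful γ∈Mx δ∈My δ∈Mz (fan₂-unhappy no-common))))
      where open Fan₂ φf≡η f[x,z] (missing⇒lacks η∈My)

lemma2p12 : (G : Multigraph) (Δ : ℕ) → 2 ≤ Δ → MaxDegree G Δ →
    (φ : Coloring G) → IsPartialColoring G (numColors Δ) φ → Proper G φ →
    (e : Edge G) → φ e ≡ nothing →
    (x y : Vertex G) → EdgeBetween G e x y →
    (α β : ℕ) → Missing G (numColors Δ) φ x α → ¬ Missing G (numColors Δ) φ y α →
    Missing G (numColors Δ) φ y β →
    (F : List (Edge G)) (γ δ : ℕ) →
    NextShannonFan G (numColors Δ) φ e x y α β F γ δ →
    ((g : Edge G) → g ∈ F →
      φ g ≢ just α × φ g ≢ just β × φ g ≢ just γ × φ g ≢ just δ)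
    ×
    ((Missing G (numColors Δ) φ x δ × HappyChain G (numColors Δ) φ F)
     ⊎ (length F ≡ 2 × δ ≡ β × HopefulFan G (numColors Δ) φ x F α β)
     ⊎ (length F ≡ 2 × δ ≢ β × SuccessfulFan G (numColors Δ) φ x F γ δ)
     ⊎ (δ ≢ β × SuccessfulEdge G φ γ δ e))
lemma2p12 G Δ _ _ φ _ proper e φe≡∅ x y e[x,y] α β α∈Mx _ _ F γ δ nsf = nsf-avoids nsf , nsf-outcome nsf
  where open ShannonFan {G} {numColors Δ} proper φe≡∅ e[x,y] {α} {β} α∈Mx
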